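{- For every integer $n\ge 0$, \[ \binom{2n}{n}\sum_{k=0}^{n}\binom{n}{k}\binom{n+k}{n}\binom{2k}{k}\binom{n+k}{n-k}=\binom{2n}{n}\sum_{k=0}^{n}\binom{n}{k}^2\binom{n+k}{n}^2. \]
   Context: $\binom{m}{j}$ is the usual binomial coefficient. -}

module Defs where

-- For k ≤ n, both C(2k,k) C(n+k,n−k) and C(n,k) C(n+k,n) equal the trinomial coefficient
-- (n+k)! / ((n−k)! k! k!): they choose blocks of sizes n−k, k, k out of n+k in two orders.
-- So the left summands are exactly the right summands, whatever the common factor C(2n,n).
module Submission where

open import Defs
open import Data.Nat using (ℕ; _+_; _*_; _∸_; _^_; suc; _!; _≤_; NonZero)
open import Data.Nat.Combinatorics using (_C_; nCk≡n!/k![n-k]!; k![n∸k]!∣n!)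
open import Data.List using (map; upTo)
open import Data.Nat.ListAction using (sum)
open import Relation.Binary.PropositionalEquality using (_≡_; refl; sym; trans; cong; subst; module ≡-Reasoning)
open import Data.Nat.Properties
  using (m≤m+n; m≤n+m; m+n∸m≡n; m+n∸n≡m; m∸n+n≡m; +-assoc; +-identityʳ; *-comm; *-cancelʳ-≡; m*n≢0; ≤-pred; _!≢0; _!*_!≢0)
open import Data.Nat.DivMod using (m/n*n≡m)
open import Data.List.Properties using (map-cong-local)
open import Data.List.Membership.Propositional using (_∈_)
open import Data.List.Membership.Propositional.Properties using (∈-upTo⁻)
open import Data.List.Relation.Unary.All using (tabulate)
open import Data.Nat.Solver using (module +-*-Solver)
open +-*-Solver using (solve; _:*_; _:^_; _:=_)

nCk*k!*[n∸k]!≡n! : ∀ {n k} → k ≤ n → (n C k) * (k ! * (n ∸ k) !) ≡ n !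
nCk*k!*[n∸k]!≡n! {n} {k} k≤n = trans (cong (_* (k ! * (n ∸ k) !)) (nCk≡n!/k![n-k]! k≤n))
  (m/n*n≡m {{k !* (n ∸ k) !≢0}} (k![n∸k]!∣n! k≤n))

[m+n]Cm*m!*n!≡[m+n]! : ∀ m n → ((m + n) C m) * (m ! * n !) ≡ (m + n) !
[m+n]Cm*m!*n!≡[m+n]! m n = subst (λ r → ((m + n) C m) * (m ! * r !) ≡ (m + n) !)
  (m+n∸m≡n m n) (nCk*k!*[n∸k]!≡n! (m≤m+n m n))

[m+n]Cn*n!*m!≡[m+n]! : ∀ m n → ((m + n) C n) * (n ! * m !) ≡ (m + n) !
[m+n]Cn*n!*m!≡[m+n]! m n = subst (λ r → ((m + n) C n) * (n ! * r !) ≡ (m + n) !)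
  (m+n∸n≡m m n) (nCk*k!*[n∸k]!≡n! (m≤n+m n m))

trinomial-revision : ∀ a b c →
  ((a + b + c) C a) * ((b + c) C b) ≡ ((a + b + c) C (a + b)) * ((a + b) C b)
trinomial-revision a b c = *-cancelʳ-≡ _ _ (a ! * b ! * c !) {{a!b!c!≢0}}
  (trans choose-a-first (sym choose-a+b-first))
  where
  a!b!c!≢0 : NonZero (a ! * b ! * c !)
  a!b!c!≢0 = m*n≢0 (a ! * b !) (c !) {{m*n≢0 (a !) (b !) {{a !≢0}} {{b !≢0}}}} {{c !≢0}}

  choose-a-first : ((a + b + c) C a) * ((b + c) C b) * (a ! * b ! * c !) ≡ (a + b + c) !
  choose-a-first rewrite +-assoc a b c = begin
    ((a + (b + c)) C a) * ((b + c) C b) * (a ! * b ! * c !)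
      ≡⟨ solve 5 (λ x y a! b! c! → x :* y :* (a! :* b! :* c!) := x :* (a! :* (y :* (b! :* c!))))
           refl ((a + (b + c)) C a) ((b + c) C b) (a !) (b !) (c !) ⟩
    ((a + (b + c)) C a) * (a ! * (((b + c) C b) * (b ! * c !)))
      ≡⟨ cong (λ r → ((a + (b + c)) C a) * (a ! * r)) ([m+n]Cm*m!*n!≡[m+n]! b c) ⟩
    ((a + (b + c)) C a) * (a ! * (b + c) !)
      ≡⟨ [m+n]Cm*m!*n!≡[m+n]! a (b + c) ⟩
    (a + (b + c)) ! ∎
    where open ≡-Reasoning

  choose-a+b-first : ((a + b + c) C (a + b)) * ((a + b) C b) * (a ! * b ! * c !) ≡ (a + b + c) !
  choose-a+b-first = begin
    ((a + b + c) C (a + b)) * ((a + b) C b) * (a ! * b ! * c !)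
      ≡⟨ solve 5 (λ x y a! b! c! → x :* y :* (a! :* b! :* c!) := x :* (y :* (b! :* a!) :* c!))
           refl ((a + b + c) C (a + b)) ((a + b) C b) (a !) (b !) (c !) ⟩
    ((a + b + c) C (a + b)) * (((a + b) C b) * (b ! * a !) * c !)
      ≡⟨ cong (λ r → ((a + b + c) C (a + b)) * (r * c !)) ([m+n]Cn*n!*m!≡[m+n]! a b) ⟩
    ((a + b + c) C (a + b)) * ((a + b) ! * c !)
      ≡⟨ [m+n]Cm*m!*n!≡[m+n]! (a + b) c ⟩
    (a + b + c) ! ∎
    where open ≡-Reasoning

[n+k]C[n∸k]*[2k]Ck≡[n+k]Cn*nCk : ∀ {n k} → k ≤ n →
  ((n + k) C (n ∸ k)) * ((2 * k) C k) ≡ ((n + k) C n) * (n C k)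
[n+k]C[n∸k]*[2k]Ck≡[n+k]Cn*nCk {n} {k} k≤n =
  subst (λ m → ((m + k) C (n ∸ k)) * ((2 * k) C k) ≡ ((m + k) C m) * (m C k))
    (m∸n+n≡m k≤n)
    (subst (λ j → ((n ∸ k + k + k) C (n ∸ k)) * (j C k) ≡ ((n ∸ k + k + k) C (n ∸ k + k)) * ((n ∸ k + k) C k))
      (cong (k +_) (sym (+-identityʳ k)))
      (trinomial-revision (n ∸ k) k k))

square-of-product : ∀ x y z w → z * w ≡ x * y → x * y * z * w ≡ x ^ 2 * y ^ 2
square-of-product x y z w zw≡xy = begin
  x * y * z * w    ≡⟨ solve 4 (λ x y z w → x :* y :* z :* w := x :* y :* (z :* w)) refl x y z w ⟩
  x * y * (z * w)  ≡⟨ cong (x * y *_) zw≡xy ⟩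
  x * y * (x * y)  ≡⟨ solve 2 (λ x y → x :* y :* (x :* y) := x :^ 2 :* y :^ 2) refl x y ⟩
  x ^ 2 * y ^ 2    ∎
  where open ≡-Reasoning

mainTheorem14 : (n : ℕ) →
    ((2 * n) C n) * sum (map (λ k → (n C k) * ((n + k) C n) * ((2 * k) C k) * ((n + k) C (n ∸ k))) (upTo (suc n)))
      ≡ ((2 * n) C n) * sum (map (λ k → ((n C k) ^ 2) * (((n + k) C n) ^ 2)) (upTo (suc n)))
mainTheorem14 n = cong (λ terms → ((2 * n) C n) * sum terms) (map-cong-local (tabulate summands-agree))
  where
  summands-agree : ∀ {k} → k ∈ upTo (suc n) →
    (n C k) * ((n + k) C n) * ((2 * k) C k) * ((n + k) C (n ∸ k)) ≡ (n C k) ^ 2 * ((n + k) C n) ^ 2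
  summands-agree {k} k∈ = square-of-product (n C k) ((n + k) C n) ((2 * k) C k) ((n + k) C (n ∸ k))
    (trans (*-comm ((2 * k) C k) _)
      (trans ([n+k]C[n∸k]*[2k]Ck≡[n+k]Cn*nCk (≤-pred (∈-upTo⁻ k∈))) (*-comm _ (n C k))))
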